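{- Let $s \geq 1$ be an integer and, for $n \geq 0$, let $f(n)$ denote the number of linear extensions of the uneven type-$\alpha$ comb $\alpha^{\ast}_{s}(n)$ that avoid both patterns $231$ and $312$. Then $$f(n) = \begin{cases} 1 & \text{if } n \leq s,\\ 2^{n-s} & \text{if } s < n < 2s,\\ 2f(n-1) - f(n-s-1) & \text{if } n \geq 2s.\end{cases}$$
   Context: A linear extension of a finite poset $P$ on a set of integers is a listing $v=[v_1,\dots,v_n]$ of all elements of $P$, each exactly once, such that whenever $a \leq_P b$, $a$ appears before $b$. For $w \in S_3$, a sequence $v$ of distinct integers contains $w$ if there are indices $i<j<k$ with $(v_i,v_j,v_k)$ in the same relative order as $(w_1,w_2,w_3)$; otherwise $v$ avoids $w$. The uneven type-$\alpha$ comb $\alpha^{\ast}_{s}(n)$ with $s$ teeth and $n$ elements is the poset on $\{1,\dots,n\}$ whose order is generated by the relations $i \leq i+1$ for $1 \leq i < \min(s,n)$ (the spine) and $x \leq x+s$ for $1 \leq x \leq n-s$ (the teeth $c, c+s, c+2s, \dots$ for $1 \le c \le s$, truncated at $n$). When $n = ts$, this is the type-$\alpha$ comb with $s$ teeth of length $t$. -}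

module Defs where

open import Data.Nat using (ℕ; zero; suc; _+_; _≤_; _<_)
open import Data.Fin using (Fin; toℕ)
open import Data.List using (List; length; lookup; map; upTo)
open import Data.Product using (∃-syntax; _×_)
open import Relation.Nullary using (¬_)
open import Relation.Binary.PropositionalEquality using (_≡_)
open import Relation.Binary.Construct.Closure.ReflexiveTransitive using (Star)
open import Data.List.Relation.Binary.Permutation.Propositional using (_↭_)

-- Generating relations of the uneven type-α comb α*_s(n) on {1,…,n}:
-- spine  i ≤ i+1  for 1 ≤ i < min(s,n);  teeth  x ≤ x+s  for 1 ≤ x ≤ n-s.
data Gen (s n : ℕ) : ℕ → ℕ → Set where
  spine : ∀ {i} → 1 ≤ i → suc i ≤ s → suc i ≤ n → Gen s n i (suc i)
  tooth : ∀ {x} → 1 ≤ x → x + s ≤ n → Gen s n x (x + s)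

_≤[_,_]_ : ℕ → ℕ → ℕ → ℕ → Set
a ≤[ s , n ] b = Star (Gen s n) a b

ground : ℕ → List ℕ
ground n = map suc (upTo n)

IsLinExt : ℕ → ℕ → List ℕ → Set
IsLinExt s n v =
  (v ↭ ground n) ×
  (∀ (i j : Fin (length v)) → lookup v i ≤[ s , n ] lookup v j → toℕ i ≤ toℕ j)

Contains231 : List ℕ → Set
Contains231 v = ∃[ i ] ∃[ j ] ∃[ k ]
  (toℕ {length v} i < toℕ j × toℕ j < toℕ k ×
   lookup v k < lookup v i × lookup v i < lookup v j)

Contains312 : List ℕ → Set
Contains312 v = ∃[ i ] ∃[ j ] ∃[ k ]
  (toℕ {length v} i < toℕ j × toℕ j < toℕ k ×
   lookup v j < lookup v k × lookup v k < lookup v i)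

Good : ℕ → ℕ → List ℕ → Set
Good s n v = IsLinExt s n v × ¬ Contains231 v × ¬ Contains312 v

-- A permutation avoiding 231 and 312 ends with a decreasing run c + B, …, c + 1
-- of its largest values, preceded by such a permutation of 1, …, c. It is a
-- linear extension of α*_s(c + B) exactly when the prefix is one of α*_s(c) and
-- the run contains no relation of the comb, i.e. B ≤ s and, if B ≥ 2, s ≤ c + 1.
-- Hence f(n) = f(n - 1) + … + f(n - K(n)) with K(n) = max(1, min(s, n + 1 - s)):
-- K is 1 up to s, grows by one per step between s and 2s (so f doubles), and is
-- s from 2s - 1 on, where consecutive sums differ by f(n - 1) - f(n - 1 - s).
module Submission where

open import Defs
open import Data.Nat using (ℕ; zero; suc; _+_; _*_; _∸_; _^_; _≤_; _<_; z≤n; s≤s; _⊔_; _⊓_)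
open import Data.Nat.Properties
open import Data.Fin using (Fin; toℕ; fromℕ<)
import Data.Fin as Fin
open import Data.Fin.Properties using (toℕ<n; toℕ-fromℕ<)
open import Data.List using (List; []; _∷_; _++_; length; lookup; map; upTo; [_])
open import Data.List.Properties
  using (length-++; length-map; length-upTo; upTo-∷ʳ; map-++; ++-identityʳ; ++-assoc; ++-cancelʳ)
open import Data.List.Membership.Propositional using (_∈_)
open import Data.List.Membership.Propositional.Properties
  using (∈-map⁺; ∈-map⁻; ∈-++⁺ˡ; ∈-++⁺ʳ; ∈-++⁻; ∈-∃++; ∈-upTo⁺; ∈-upTo⁻)
open import Data.List.Relation.Unary.Any using (here; there)
open import Data.List.Extrema ≤-totalOrder using (max; xs≤max; max≤v⁺)
import Data.List.Relation.Unary.All as All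
open import Data.List.Relation.Unary.AllPairs using ([]; _∷_)
open import Data.List.Relation.Unary.Unique.Propositional using (Unique)
import Data.List.Relation.Unary.Unique.Propositional.Properties as Unique
import Data.List.Relation.Binary.Permutation.Setoid.Properties as PermutationSetoid
open import Data.List.Relation.Binary.Permutation.Propositional
  using (_↭_; ↭-refl; ↭-sym; ↭-trans; ↭-reflexive; ↭⇒↭ₛ; module PermutationReasoning)
open import Data.List.Relation.Binary.Permutation.Propositional.Properties
  using (∈-resp-↭; ↭-length; ++⁺ˡ; ++⁺ʳ; drop-mid; ∷↭∷ʳ; ↭-empty-inv)
open import Data.Product using (Σ; ∃-syntax; _×_; _,_; proj₁; proj₂)
open import Data.Sum using (_⊎_; inj₁; inj₂)
open import Data.Empty using (⊥; ⊥-elim)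
open import Function.Bundles using (_⇔_; mk⇔)
open import Function.Base using (_∘_)
open import Relation.Nullary using (¬_; yes; no)
open import Relation.Binary.PropositionalEquality
  using (_≡_; refl; sym; trans; cong; cong₂; subst; subst₂; setoid; module ≡-Reasoning)
open import Relation.Binary.Construct.Closure.ReflexiveTransitive using (Star; ε; _◅_) renaming (map to mapStar)
open import Relation.Binary.Definitions using (tri<; tri≈; tri>)

-- Positions are natural numbers; `at` returns the junk value 0 out of range,
-- so every use carries a bound on the position.
at : List ℕ → ℕ → ℕ
at []       _       = 0
at (x ∷ xs) zero    = x
at (x ∷ xs) (suc i) = at xs i

lookup≡at : (v : List ℕ) (i : Fin (length v)) → lookup v i ≡ at v (toℕ i)
lookup≡at (x ∷ v) Fin.zero    = refl
lookup≡at (x ∷ v) (Fin.suc i) = lookup≡at v i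

at∈ : ∀ v {i} → i < length v → at v i ∈ v
at∈ (x ∷ v) {zero}  _       = here refl
at∈ (x ∷ v) {suc i} (s≤s i<) = there (at∈ v i<)

∈⇒at : ∀ {x} v → x ∈ v → ∃[ i ] (i < length v × at v i ≡ x)
∈⇒at (x ∷ v) (here refl) = 0 , s≤s z≤n , refl
∈⇒at (y ∷ v) (there x∈v) with i , i< , eq ← ∈⇒at v x∈v = suc i , s≤s i< , eq

at-injective : ∀ {v} → Unique v → ∀ {i j} → i < length v → j < length v → at v i ≡ at v j → i ≡ j
at-injective (_ ∷ _) {zero} {zero} _ _ _ = refl
at-injective {x ∷ v} (x∉v ∷ _) {zero} {suc j} _ (s≤s j<) eq = ⊥-elim (All.lookup x∉v (at∈ v j<) eq)
at-injective {x ∷ v} (x∉v ∷ _) {suc i} {zero} (s≤s i<) _ eq = ⊥-elim (All.lookup x∉v (at∈ v i<) (sym eq))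
at-injective (_ ∷ v!) {suc i} {suc j} (s≤s i<) (s≤s j<) eq = cong suc (at-injective v! i< j< eq)

at-++ˡ : ∀ w u {i} → i < length w → at (w ++ u) i ≡ at w i
at-++ˡ (x ∷ w) u {zero}  _        = refl
at-++ˡ (x ∷ w) u {suc i} (s≤s i<) = at-++ˡ w u i<

at-++ʳ : ∀ w u j → at (w ++ u) (length w + j) ≡ at u j
at-++ʳ []      u j = refl
at-++ʳ (x ∷ w) u j = at-++ʳ w u j

at-length : ∀ w {x} r → at (w ++ x ∷ r) (length w) ≡ x
at-length []      r = refl
at-length (y ∷ w) r = at-length w r

data PositionIn++ (w u : List ℕ) : ℕ → Set where
  inˡ : ∀ {i} → i < length w → at (w ++ u) i ≡ at w i → PositionIn++ w u i
  inʳ : ∀ {j} → j < length u → at (w ++ u) (length w + j) ≡ at u j → PositionIn++ w u (length w + j)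

positionIn++ : ∀ w u {p} → p < length (w ++ u) → PositionIn++ w u p
positionIn++ w u {p} p< with p <? length w
... | yes p<w = inˡ p<w (at-++ˡ w u p<w)
... | no p≮w rewrite sym (m+[n∸m]≡n (≮⇒≥ p≮w)) =
  inʳ (+-cancelˡ-< (length w) _ _ (subst (_ <_) (length-++ w) p<)) (at-++ʳ w u _)

Decreasing : List ℕ → Set
Decreasing r = ∀ {i j} → i < j → j < length r → at r j < at r i

decRun : ℕ → ℕ → List ℕ
decRun c zero    = []
decRun c (suc b) = suc (c + b) ∷ decRun c b

length-decRun : ∀ c b → length (decRun c b) ≡ b
length-decRun c zero    = refl
length-decRun c (suc b) = cong suc (length-decRun c b)

at-decRun : ∀ c {b j} → j < b → at (decRun c b) j ≡ c + (b ∸ j)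
at-decRun c {suc b} {zero}  _        = sym (+-suc c b)
at-decRun c {suc b} {suc j} (s≤s j<) = at-decRun c j<

decRun-decreasing : ∀ c b → Decreasing (decRun c b)
decRun-decreasing c b {i} {j} i<j j<
  rewrite length-decRun c b | at-decRun c j< | at-decRun c (<-trans i<j j<) =
  +-monoʳ-< c (∸-monoʳ-< i<j (<⇒≤ j<))

∈-decRun⁻ : ∀ {x} c b → x ∈ decRun c b → c < x × x ≤ c + b
∈-decRun⁻ c (suc b) (here refl) = s≤s (m≤m+n c b) , ≤-reflexive (sym (+-suc c b))
∈-decRun⁻ c (suc b) (there x∈) with c<x , x≤ ← ∈-decRun⁻ c b x∈ =
  c<x , ≤-trans x≤ (+-monoʳ-≤ c (n≤1+n b))

∈-decRun⁺ : ∀ {x} c b → c < x → x ≤ c + b → x ∈ decRun c b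
∈-decRun⁺ {x} c zero c<x x≤ = ⊥-elim (<⇒≱ c<x (subst (x ≤_) (+-identityʳ c) x≤))
∈-decRun⁺ {x} c (suc b) c<x x≤ with x ≟ suc (c + b)
... | yes refl = here refl
... | no x≢ = there (∈-decRun⁺ c b c<x (≤-pred (≤∧≢⇒< (subst (x ≤_) (+-suc c b) x≤) x≢)))

decreasing-interval : ∀ c b {r} → Decreasing r →
  (∀ {y} → y ∈ r → c < y × y ≤ c + b) → (∀ {y} → c < y → y ≤ c + b → y ∈ r) → r ≡ decRun c b
decreasing-interval c zero {[]} _ _ _ = refl
decreasing-interval c zero {y ∷ r} _ bounded _ with c<y , y≤ ← bounded (here refl) =
  ⊥-elim (<⇒≱ c<y (subst (y ≤_) (+-identityʳ c) y≤))
decreasing-interval c (suc b) {[]} _ _ complete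
  with () ← complete {suc (c + b)} (s≤s (m≤m+n c b)) (≤-reflexive (sym (+-suc c b)))
decreasing-interval c (suc b) {y ∷ r} dec bounded complete =
  cong₂ _∷_ y≡top (decreasing-interval c b (λ i<j j< → dec (s≤s i<j) (s≤s j<)) bounded′ complete′)
  where
  below-y : ∀ {z} → z ∈ r → z < y
  below-y z∈r with j , j< , refl ← ∈⇒at r z∈r = dec (s≤s z≤n) (s≤s j<)
  top-bound : suc (c + b) ∈ y ∷ r → suc (c + b) ≤ y
  top-bound (here eq)     = ≤-reflexive eq
  top-bound (there top∈r) = <⇒≤ (below-y top∈r)
  y≡top : y ≡ suc (c + b)
  y≡top = ≤-antisym (subst (y ≤_) (+-suc c b) (proj₂ (bounded (here refl))))
                    (top-bound (complete (s≤s (m≤m+n c b)) (≤-reflexive (sym (+-suc c b)))))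
  bounded′ : ∀ {z} → z ∈ r → c < z × z ≤ c + b
  bounded′ z∈r = proj₁ (bounded (there z∈r)) , ≤-pred (subst (_ <_) y≡top (below-y z∈r))
  complete′ : ∀ {z} → c < z → z ≤ c + b → z ∈ r
  complete′ c<z z≤ with complete c<z (≤-trans z≤ (+-monoʳ-≤ c (n≤1+n b)))
  ... | here refl = ⊥-elim (<-irrefl y≡top (s≤s z≤))
  ... | there z∈r = z∈r

Occurs : (ℕ → ℕ → ℕ → Set) → List ℕ → Set
Occurs P v = ∃[ i ] ∃[ j ] ∃[ k ] (i < j × j < k × k < length v × P (at v i) (at v j) (at v k))

Shape231 Shape312 : ℕ → ℕ → ℕ → Set
Shape231 a b c = c < a × a < b
Shape312 a b c = b < c × c < a

occurs-++ˡ : ∀ {P} w u → Occurs P w → Occurs P (w ++ u)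
occurs-++ˡ {P} w u (i , j , k , i<j , j<k , k< , p) =
  i , j , k , i<j , j<k , k<w++u ,
  subst₂ (λ a b → P a b _) (sym (at-++ˡ w u i<)) (sym (at-++ˡ w u j<)) (subst (P _ _) (sym (at-++ˡ w u k<)) p)
  where
  k<w++u = subst (k <_) (sym (length-++ w)) (≤-trans k< (m≤m+n _ _))
  j< = <-trans j<k k<
  i< = <-trans i<j j<

-- A straddling occurrence would put a value of u below a value of w.
occurs-++⁻ : ∀ {P} → (∀ a b c → P a b c → c < a) →
  ∀ w u → (∀ {x y} → x ∈ w → y ∈ u → x < y) → Occurs P (w ++ u) → Occurs P w ⊎ Occurs P u
occurs-++⁻ {P} last<first w u w<u (i , j , k , i<j , j<k , k< , p)
  with positionIn++ w u k< | positionIn++ w u (<-trans i<j (<-trans j<k k<))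
... | inˡ k<w at-k | _ =
  inj₁ (i , j , k , i<j , j<k , k<w ,
    subst₂ (λ a b → P a b _) (at-++ˡ w u i<) (at-++ˡ w u j<) (subst (P _ _) at-k p))
  where
  j< = <-trans j<k k<w
  i< = <-trans i<j j<
... | inʳ {k′} k′< at-k | inˡ i<w at-i =
  ⊥-elim (<-asym (last<first _ _ _ p) (subst₂ _<_ (sym at-i) (sym at-k) (w<u (at∈ w i<w) (at∈ u k′<))))
... | inʳ {k′} k′< at-k | inʳ {i′} i′< at-i =
  inj₂ (i′ , j′ , k′ , +-cancelˡ-< (length w) _ _ (subst (_ <_) j≡ i<j) ,
    +-cancelˡ-< (length w) _ _ (subst (_< _) j≡ j<k) , k′< ,
    subst₂ (λ a b → P a b _) at-i (trans (cong (at (w ++ u)) j≡) (at-++ʳ w u j′)) (subst (P _ _) at-k p))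
  where
  j′ = j ∸ length w
  j≡ : j ≡ length w + j′
  j≡ = sym (m+[n∸m]≡n (≤-trans (m≤m+n _ i′) (<⇒≤ i<j)))

decreasing⇒¬occurs : ∀ {P} → (∀ a b c → P a b c → a < b ⊎ b < c) →
  ∀ {r} → Decreasing r → ¬ Occurs P r
decreasing⇒¬occurs ascent dec (i , j , k , i<j , j<k , k< , p) with ascent _ _ _ p
... | inj₁ a<b = <-asym a<b (dec i<j (<-trans j<k k<))
... | inj₂ b<c = <-asym b<c (dec j<k k<)

length-ground : ∀ n → length (ground n) ≡ n
length-ground n = trans (length-map suc (upTo n)) (length-upTo n)

ground-unique : ∀ n → Unique (ground n)
ground-unique n = Unique.map⁺ suc-injective (Unique.upTo⁺ n)

∈-ground⁻ : ∀ {x} n → x ∈ ground n → 1 ≤ x × x ≤ n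
∈-ground⁻ n x∈ with y , y∈ , refl ← ∈-map⁻ suc x∈ = s≤s z≤n , ∈-upTo⁻ y∈

∈-ground⁺ : ∀ {x} n → 1 ≤ x → x ≤ n → x ∈ ground n
∈-ground⁺ n (s≤s _) x≤n = ∈-map⁺ suc (∈-upTo⁺ x≤n)

ground-suc : ∀ n → ground (suc n) ≡ ground n ++ [ suc n ]
ground-suc n = trans (cong (map suc) (sym (upTo-∷ʳ n))) (map-++ suc (upTo n) [ n ])

ground-++ : ∀ c b → ground (c + b) ↭ ground c ++ decRun c b
ground-++ c zero rewrite +-identityʳ c | ++-identityʳ (ground c) = ↭-refl
ground-++ c (suc b) = begin
  ground (c + suc b)                      ≡⟨ cong ground (+-suc c b) ⟩
  ground (suc (c + b))                    ≡⟨ ground-suc (c + b) ⟩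
  ground (c + b) ++ [ suc (c + b) ]        ↭⟨ ++⁺ʳ _ (ground-++ c b) ⟩
  (ground c ++ decRun c b) ++ [ suc (c + b) ] ≡⟨ ++-assoc (ground c) _ _ ⟩
  ground c ++ decRun c b ++ [ suc (c + b) ] ↭⟨ ++⁺ˡ (ground c) (↭-sym (∷↭∷ʳ _ (decRun c b))) ⟩
  ground c ++ decRun c (suc b)            ∎
  where open PermutationReasoning

++-cancelʳ-↭ : ∀ (d : List ℕ) {w g} → w ++ d ↭ g ++ d → w ↭ g
++-cancelʳ-↭ []      {w} {g} p rewrite ++-identityʳ w | ++-identityʳ g = p
++-cancelʳ-↭ (x ∷ d) {w} {g} p = ++-cancelʳ-↭ d (drop-mid w g p)

↭-unique : ∀ {xs ys : List ℕ} → xs ↭ ys → Unique xs → Unique ys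
↭-unique p = PermutationSetoid.Unique-resp-↭ (setoid ℕ) (↭⇒↭ₛ p)

InOrder : (ℕ → ℕ → Set) → List ℕ → Set
InOrder R v = ∀ {i k} → i < length v → k < length v → R (at v i) (at v k) → i ≤ k

inOrder-star : ∀ {R v} → Unique v → (∀ {x z} → R x z → z ∈ v) → InOrder R v → InOrder (Star R) v
inOrder-star {R} {v} v! R⊆v ordered i< k< r = go r i< k< refl refl
  where
  go : ∀ {x z} → Star R x z →
       ∀ {i k} → i < length v → k < length v → at v i ≡ x → at v k ≡ z → i ≤ k
  go ε       i< k< refl eq = ≤-reflexive (at-injective v! i< k< (sym eq))
  go (r ◅ rs) {i} i< k< refl eq with j , j< , refl ← ∈⇒at v (R⊆v r) =
    ≤-trans (ordered i< j< r) (go rs j< k< refl eq)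

inOrder-++ˡ : ∀ {R} w u → InOrder R (w ++ u) → InOrder R w
inOrder-++ˡ {R} w u ordered i< k< r =
  ordered (lift i<) (lift k<) (subst₂ R (sym (at-++ˡ w u i<)) (sym (at-++ˡ w u k<)) r)
  where
  lift : ∀ {p} → p < length w → p < length (w ++ u)
  lift p< = subst (_ <_) (sym (length-++ w)) (≤-trans p< (m≤m+n _ _))

inOrder-++ʳ : ∀ {R} w u → InOrder R (w ++ u) → InOrder R u
inOrder-++ʳ {R} w u ordered {i} {k} i< k< r =
  +-cancelˡ-≤ (length w) i k (ordered (lift i<) (lift k<) (subst₂ R (sym (at-++ʳ w u i)) (sym (at-++ʳ w u k)) r))
  where
  lift : ∀ {p} → p < length u → length w + p < length (w ++ u)
  lift p< = subst (_ <_) (sym (length-++ w)) (+-monoʳ-< (length w) p<)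

inOrder-++ : ∀ {R} w u → InOrder R w → (∀ {x y} → x ∈ u → ¬ R x y) → InOrder R (w ++ u)
inOrder-++ {R} w u ordered u-minimal {i} {k} i< k< r with positionIn++ w u i< | positionIn++ w u k<
... | inˡ i<w at-i | inˡ k<w at-k = ordered i<w k<w (subst₂ R at-i at-k r)
... | inˡ i<w _    | inʳ _ _     = ≤-trans (<⇒≤ i<w) (m≤m+n _ _)
... | inʳ j< at-i  | _           = ⊥-elim (u-minimal (at∈ u j<) (subst (λ x → R x _) at-i r))

decreasing-inOrder : ∀ {R r} → Decreasing r → InOrder R r →
  ∀ {x z} → x ∈ r → z ∈ r → R x z → z ≤ x
decreasing-inOrder {R} {r} dec ordered x∈ z∈ xRz
  with i , i< , refl ← ∈⇒at r x∈ | k , k< , refl ← ∈⇒at r z∈ with <-cmp i k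
... | tri< i<k _ _ = <⇒≤ (dec i<k k<)
... | tri≈ _ refl _ = ≤-refl
... | tri> _ _ k<i = ⊥-elim (<⇒≱ k<i (ordered i< k< xRz))

unique-++⁻ : ∀ w {r : List ℕ} → Unique (w ++ r) → Unique r × (∀ {x} → x ∈ w → x ∈ r → ⊥)
unique-++⁻ []      r!         = r! , λ ()
unique-++⁻ (x ∷ w) (x∉ ∷ wr!) with r! , disjoint ← unique-++⁻ w wr! = r! , λ where
  (here refl) x∈r → All.lookup x∉ (∈-++⁺ʳ w x∈r) refl
  (there y∈w) y∈r → disjoint y∈w y∈r

split-at-max : ∀ {m v} → v ↭ ground (suc m) → ∃[ w ] ∃[ r ] (v ≡ w ++ suc m ∷ r × w ++ r ↭ ground m)
split-at-max {m} perm
  with w , r , refl ← ∈-∃++ (∈-resp-↭ (↭-sym perm) (∈-ground⁺ (suc m) (s≤s z≤n) ≤-refl)) =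
  w , r , refl ,
  subst (w ++ r ↭_) (++-identityʳ (ground m))
    (drop-mid w (ground m) (↭-trans perm (↭-reflexive (ground-suc m))))

-- A larger value before the maximum and a smaller one after it form a 231;
-- an ascent after the maximum forms a 312 with it.
avoider-around-max : ∀ {m} w r → w ++ r ↭ ground m →
  ¬ Occurs Shape231 (w ++ suc m ∷ r) → ¬ Occurs Shape312 (w ++ suc m ∷ r) →
  (∀ {x y} → x ∈ w → y ∈ r → x < y) × Decreasing r
avoider-around-max {m} w r perm no231 no312 = w<r , r-decreasing
  where
  v = w ++ suc m ∷ r
  p = length w
  r! = proj₁ (unique-++⁻ w (↭-unique (↭-sym perm) (ground-unique m)))
  disjoint = proj₂ (unique-++⁻ w (↭-unique (↭-sym perm) (ground-unique m)))
  ≤m : ∀ {x} → x ∈ w ++ r → x ≤ m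
  ≤m x∈ = proj₂ (∈-ground⁻ m (∈-resp-↭ perm x∈))
  pos-r : ∀ {j} → j < length r → p + suc j < length v
  pos-r j< = subst (_ <_) (sym (length-++ w)) (+-monoʳ-< p (s≤s j<))
  at-r : ∀ j → at r j ≡ at v (p + suc j)
  at-r j = sym (at-++ʳ w (suc m ∷ r) (suc j))
  at-top : suc m ≡ at v p
  at-top = sym (at-length w r)

  w<r : ∀ {x y} → x ∈ w → y ∈ r → x < y
  w<r x∈ y∈ with i , i< , refl ← ∈⇒at w x∈ | j , j< , refl ← ∈⇒at r y∈ with <-cmp (at w i) (at r j)
  ... | tri< lt _ _ = lt
  ... | tri≈ _ eq _ = ⊥-elim (disjoint x∈ (subst (_∈ r) (sym eq) y∈))
  ... | tri> _ _ gt = ⊥-elim (no231 (i , p , p + suc j , i< , m<m+n p (s≤s z≤n) , pos-r j< ,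
          subst₂ _<_ (at-r j) at-i gt , subst₂ _<_ at-i at-top (s≤s (≤m (∈-++⁺ˡ x∈)))))
    where at-i = sym (at-++ˡ w (suc m ∷ r) i<)

  r-decreasing : Decreasing r
  r-decreasing {i} {j} i<j j< with <-cmp (at r j) (at r i)
  ... | tri< lt _ _ = lt
  ... | tri≈ _ eq _ = ⊥-elim (<⇒≢ i<j (at-injective r! (<-trans i<j j<) j< (sym eq)))
  ... | tri> _ _ gt = ⊥-elim (no312 (p , p + suc i , p + suc j ,
          m<m+n p (s≤s z≤n) , +-monoʳ-< p (s≤s i<j) , pos-r j< ,
          subst₂ _<_ (at-r i) (at-r j) gt , subst₂ _<_ (at-r j) at-top (s≤s (≤m (∈-++⁺ʳ w (at∈ r j<))))))

-- The cut point c is the largest value of w.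
top-segment : ∀ {m} w r → w ++ r ↭ ground m → (∀ {x y} → x ∈ w → y ∈ r → x < y) → Decreasing r →
  ∃[ c ] (c ≤ m × r ≡ decRun c (m ∸ c))
top-segment {m} w r perm w<r r-decreasing = c , c≤m ,
  decreasing-interval c (m ∸ c) r-decreasing
    (λ y∈ → c<r y∈ , subst (_ ≤_) (sym (m+[n∸m]≡n c≤m)) (≤m (∈-++⁺ʳ w y∈)))
    (λ c<y y≤ → r-complete c<y (subst (_ ≤_) (m+[n∸m]≡n c≤m) y≤))
  where
  c = max 0 w
  ≤m : ∀ {x} → x ∈ w ++ r → x ≤ m
  ≤m x∈ = proj₂ (∈-ground⁻ m (∈-resp-↭ perm x∈))
  c≤m : c ≤ m
  c≤m = max≤v⁺ z≤n (All.tabulate (≤m ∘ ∈-++⁺ˡ {ys = r}))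
  c<r : ∀ {y} → y ∈ r → c < y
  c<r {zero}  y∈ with () ← proj₁ (∈-ground⁻ m (∈-resp-↭ perm (∈-++⁺ʳ w y∈)))
  c<r {suc y} y∈ = s≤s (max≤v⁺ z≤n (All.tabulate λ x∈ → ≤-pred (w<r x∈ y∈)))
  r-complete : ∀ {y} → c < y → y ≤ m → y ∈ r
  r-complete c<y y≤m
    with ∈-++⁻ w (∈-resp-↭ (↭-sym perm) (∈-ground⁺ m (≤-trans (s≤s z≤n) c<y) y≤m))
  ... | inj₁ y∈w = ⊥-elim (<⇒≱ c<y (All.lookup (xs≤max 0 w) y∈w))
  ... | inj₂ y∈r = y∈r

avoider-lastRun : ∀ {m v} → v ↭ ground (suc m) → ¬ Occurs Shape231 v → ¬ Occurs Shape312 v →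
  ∃[ b ] ∃[ w ] (b ≤ m × v ≡ w ++ decRun (m ∸ b) (suc b))
avoider-lastRun {m} perm no231 no312
  with w , r , refl , perm′ ← split-at-max perm
  with w<r , r-decreasing ← avoider-around-max w r perm′ no231 no312
  with c , c≤m , refl ← top-segment w r perm′ w<r r-decreasing
  = m ∸ c , w , m∸n≤m m c ,
    trans (cong (λ t → w ++ suc t ∷ decRun c (m ∸ c)) (sym (m+[n∸m]≡n c≤m)))
          (cong (λ c′ → w ++ decRun c′ (suc (m ∸ c))) (sym (m∸[m∸n]≡n c≤m)))

sumBelow : (ℕ → ℕ) → ℕ → ℕ
sumBelow h zero    = 0
sumBelow h (suc k) = sumBelow h k + h k

sumBelow-suc : ∀ h k → sumBelow h (suc k) ≡ h 0 + sumBelow (h ∘ suc) k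
sumBelow-suc h zero    = +-comm 0 (h 0)
sumBelow-suc h (suc k) = begin
  sumBelow h (suc k) + h (suc k)             ≡⟨ cong (_+ h (suc k)) (sumBelow-suc h k) ⟩
  h 0 + sumBelow (h ∘ suc) k + h (suc k)     ≡⟨ +-assoc (h 0) _ _ ⟩
  h 0 + (sumBelow (h ∘ suc) k + h (suc k))   ∎
  where open ≡-Reasoning

gen-target : ∀ {s n x z} → Gen s n x z → 1 ≤ z × z ≤ n
gen-target (spine _ _ z≤) = s≤s z≤n , z≤
gen-target (tooth 1≤x z≤) = ≤-trans 1≤x (m≤m+n _ _) , z≤

gen-restrict : ∀ {s n c x z} → z ≤ c → Gen s n x z → Gen s c x z
gen-restrict z≤c (spine 1≤i i<s _) = spine 1≤i i<s z≤c
gen-restrict z≤c (tooth 1≤x _)     = tooth 1≤x z≤c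

gen-weaken : ∀ {s n c x z} → c ≤ n → Gen s c x z → Gen s n x z
gen-weaken c≤n (spine 1≤i i<s z≤c) = spine 1≤i i<s (≤-trans z≤c c≤n)
gen-weaken c≤n (tooth 1≤x z≤c)     = tooth 1≤x (≤-trans z≤c c≤n)

record Good′ (s n : ℕ) (v : List ℕ) : Set where
  field
    permutation : v ↭ ground n
    ordered     : InOrder (Star (Gen s n)) v
    avoids231   : ¬ Occurs Shape231 v
    avoids312   : ¬ Occurs Shape312 v

  length≡ : length v ≡ n
  length≡ = trans (↭-length permutation) (length-ground n)

OccursFin : (ℕ → ℕ → ℕ → Set) → List ℕ → Set
OccursFin P v = ∃[ i ] ∃[ j ] ∃[ k ]
  (toℕ {length v} i < toℕ j × toℕ j < toℕ k × P (lookup v i) (lookup v j) (lookup v k))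

InOrderFin : (ℕ → ℕ → Set) → List ℕ → Set
InOrderFin R v = ∀ (i j : Fin (length v)) → R (lookup v i) (lookup v j) → toℕ i ≤ toℕ j

lookup-fromℕ< : ∀ v {i} (i< : i < length v) → lookup v (fromℕ< i<) ≡ at v i
lookup-fromℕ< v i< = trans (lookup≡at v (fromℕ< i<)) (cong (at v) (toℕ-fromℕ< i<))

module _ {P : ℕ → ℕ → ℕ → Set} (v : List ℕ) where

  private
    resp : ∀ {a a′ b b′ c c′} → a ≡ a′ → b ≡ b′ → c ≡ c′ → P a b c → P a′ b′ c′
    resp refl refl refl p = p

  occursFin⇒occurs : OccursFin P v → Occurs P v
  occursFin⇒occurs (i , j , k , i<j , j<k , p) =
    toℕ i , toℕ j , toℕ k , i<j , j<k , toℕ<n k , resp (lookup≡at v i) (lookup≡at v j) (lookup≡at v k) p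

  occurs⇒occursFin : Occurs P v → OccursFin P v
  occurs⇒occursFin (i , j , k , i<j , j<k , k< , p) =
    fromℕ< i< , fromℕ< j< , fromℕ< k< ,
    subst₂ _<_ (sym (toℕ-fromℕ< i<)) (sym (toℕ-fromℕ< j<)) i<j ,
    subst₂ _<_ (sym (toℕ-fromℕ< j<)) (sym (toℕ-fromℕ< k<)) j<k ,
    resp (sym (lookup-fromℕ< v i<)) (sym (lookup-fromℕ< v j<)) (sym (lookup-fromℕ< v k<)) p
    where
    j< = <-trans j<k k<
    i< = <-trans i<j j<

module _ {R : ℕ → ℕ → Set} (v : List ℕ) where

  inOrderFin⇒inOrder : InOrderFin R v → InOrder R v
  inOrderFin⇒inOrder ordered i< k< r =
    subst₂ _≤_ (toℕ-fromℕ< i<) (toℕ-fromℕ< k<)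
      (ordered (fromℕ< i<) (fromℕ< k<) (subst₂ R (sym (lookup-fromℕ< v i<)) (sym (lookup-fromℕ< v k<)) r))

  inOrder⇒inOrderFin : InOrder R v → InOrderFin R v
  inOrder⇒inOrderFin ordered i k r = ordered (toℕ<n i) (toℕ<n k) (subst₂ R (lookup≡at v i) (lookup≡at v k) r)

good⇒good′ : ∀ {s n v} → Good s n v → Good′ s n v
good⇒good′ {s} {n} {v} ((perm , ordered) , no231 , no312) = record
  { permutation = perm
  ; ordered     = inOrderFin⇒inOrder {Star (Gen s n)} v ordered
  ; avoids231   = no231 ∘ occurs⇒occursFin {Shape231} v
  ; avoids312   = no312 ∘ occurs⇒occursFin {Shape312} v
  }

good′⇒good : ∀ {s n v} → Good′ s n v → Good s n v
good′⇒good {s} {n} {v} good =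
  (permutation , inOrder⇒inOrderFin {Star (Gen s n)} v ordered) ,
  avoids231 ∘ occursFin⇒occurs {Shape231} v , avoids312 ∘ occursFin⇒occurs {Shape312} v
  where open Good′ good

-- s = suc s′ teeth, so that s ≥ 1 holds by construction.
module UnevenComb (s′ : ℕ) where

  s : ℕ
  s = suc s′

  gen-increasing : ∀ {n x z} → Gen s n x z → x < z
  gen-increasing (spine _ _ _) = n<1+n _
  gen-increasing (tooth _ _)   = m<m+n _ (s≤s z≤n)

  -- The run c + B, …, c + 1 may close a linear extension of α*_s(c + B):
  -- it must not contain a tooth, nor a spine edge when B ≥ 2.
  RunFits : ℕ → ℕ → Set
  RunFits c B = B ≤ s × (B ≤ 1 ⊎ s ≤ suc c)

  runFits⇒sources≤ : ∀ {c B x z} → RunFits c B → Gen s (c + B) x z → x ≤ c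
  runFits⇒sources≤ {c} {B} (_ , inj₁ B≤1) (spine _ _ i+1≤c+B) =
    ≤-pred (≤-trans i+1≤c+B (subst (c + B ≤_) (+-comm c 1) (+-monoʳ-≤ c B≤1)))
  runFits⇒sources≤ (_ , inj₂ s≤c+1) (spine _ i+1≤s _) = ≤-pred (≤-trans i+1≤s s≤c+1)
  runFits⇒sources≤ {c} {x = x} (B≤s , _) (tooth _ x+s≤c+B) =
    +-cancelʳ-≤ s x c (≤-trans x+s≤c+B (+-monoʳ-≤ c B≤s))

  sources≤⇒runFits : ∀ {c B} → (∀ {x z} → Gen s (c + B) x z → x ≤ c) → RunFits c B
  sources≤⇒runFits {c} {B} sources≤ = B≤s , short-or-late
    where
    B≤s : B ≤ s
    B≤s with B ≤? s
    ... | yes B≤s = B≤s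
    ... | no B≰s = ⊥-elim (1+n≰n (sources≤ (tooth (s≤s z≤n)
            (subst (_≤ c + B) (+-suc c s) (+-monoʳ-≤ c (≰⇒> B≰s))))))
    short-or-late : B ≤ 1 ⊎ s ≤ suc c
    short-or-late with B ≤? 1 | s ≤? suc c
    ... | yes B≤1 | _       = inj₁ B≤1
    ... | no _    | yes s≤  = inj₂ s≤
    ... | no B≰1  | no s≰   = ⊥-elim (1+n≰n (sources≤ (spine (s≤s z≤n) (≰⇒> s≰)
            (subst (_≤ c + B) (+-comm c 2) (+-monoʳ-≤ c (≰⇒> B≰1))))))

  good-++⁺ : ∀ {c B w} → RunFits c B → Good′ s c w → Good′ s (c + B) (w ++ decRun c B)
  good-++⁺ {c} {B} {w} fits good = record
    { permutation = v-perm
    ; ordered     = inOrder-star (↭-unique (↭-sym v-perm) (ground-unique (c + B))) target∈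
                      (inOrder-++ {Gen s (c + B)} w run w-ordered run-sources)
    ; avoids231   = avoids (λ _ _ _ → proj₁) (λ _ _ _ → inj₁ ∘ proj₂) W.avoids231
    ; avoids312   = avoids (λ _ _ _ → proj₂) (λ _ _ _ → inj₂ ∘ proj₁) W.avoids312
    }
    where
    module W = Good′ good
    run = decRun c B
    v-perm : w ++ run ↭ ground (c + B)
    v-perm = ↭-trans (++⁺ʳ run W.permutation) (↭-sym (ground-++ c B))
    w≤c : ∀ {x} → x ∈ w → x ≤ c
    w≤c x∈ = proj₂ (∈-ground⁻ c (∈-resp-↭ W.permutation x∈))
    target∈ : ∀ {x z} → Gen s (c + B) x z → z ∈ w ++ run
    target∈ g = ∈-resp-↭ (↭-sym v-perm) (∈-ground⁺ (c + B) (proj₁ (gen-target g)) (proj₂ (gen-target g)))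
    w-ordered : InOrder (Gen s (c + B)) w
    w-ordered i< k< g = W.ordered i< k< (gen-restrict (w≤c (at∈ w k<)) g ◅ ε)
    c<run : ∀ {y} → y ∈ run → c < y
    c<run y∈ = proj₁ (∈-decRun⁻ c B y∈)
    run-sources : ∀ {x y} → x ∈ run → ¬ Gen s (c + B) x y
    run-sources x∈ g = <⇒≱ (c<run x∈) (runFits⇒sources≤ fits g)
    avoids : ∀ {P} → (∀ a b c → P a b c → c < a) → (∀ a b c → P a b c → a < b ⊎ b < c) →
      ¬ Occurs P w → ¬ Occurs P (w ++ run)
    avoids last<first ascent w-avoids occ
      with occurs-++⁻ last<first w run (λ x∈ y∈ → ≤-<-trans (w≤c x∈) (c<run y∈)) occ
    ... | inj₁ occ-w   = w-avoids occ-w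
    ... | inj₂ occ-run = decreasing⇒¬occurs ascent {run} (decRun-decreasing c B) occ-run

  good-++⁻ : ∀ {c B w} → Good′ s (c + B) (w ++ decRun c B) → Good′ s c w × RunFits c B
  good-++⁻ {c} {B} {w} good = w-good , sources≤⇒runFits sources≤
    where
    module V = Good′ good
    run = decRun c B
    w-good : Good′ s c w
    w-good = record
      { permutation = ++-cancelʳ-↭ run (↭-trans V.permutation (ground-++ c B))
      ; ordered     = λ i< k< r →
          inOrder-++ˡ {Star (Gen s (c + B))} w run V.ordered i< k< (mapStar (gen-weaken (m≤m+n c B)) r)
      ; avoids231   = V.avoids231 ∘ occurs-++ˡ {Shape231} w run
      ; avoids312   = V.avoids312 ∘ occurs-++ˡ {Shape312} w run
      }
    -- Inside the decreasing run an edge x → z would be listed as z before x.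
    sources≤ : ∀ {x z} → Gen s (c + B) x z → x ≤ c
    sources≤ {x} g with x ≤? c
    ... | yes x≤c = x≤c
    ... | no x≰c  = ⊥-elim (<⇒≱ x<z
          (decreasing-inOrder {r = run} (decRun-decreasing c B)
            (inOrder-++ʳ {Star (Gen s (c + B))} w run V.ordered) x∈ z∈ (g ◅ ε)))
      where
      x<z = gen-increasing g
      z≤ = proj₂ (gen-target g)
      x∈ = ∈-decRun⁺ c B (≰⇒> x≰c) (≤-trans (<⇒≤ x<z) z≤)
      z∈ = ∈-decRun⁺ c B (<-trans (≰⇒> x≰c) x<z) z≤

  -- The longest run that may close a linear extension of α*_s(n).
  maxRun : ℕ → ℕ
  maxRun n = 1 ⊔ (s ⊓ (suc n ∸ s))

  runFits⇒≤maxRun : ∀ {c B} → RunFits c B → B ≤ maxRun (c + B)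
  runFits⇒≤maxRun {c} {B} (_ , inj₁ B≤1) = ≤-trans B≤1 (m≤m⊔n 1 (s ⊓ (suc (c + B) ∸ s)))
  runFits⇒≤maxRun {c} {B} (B≤s , inj₂ s≤c+1) =
    ≤-trans (⊓-glb B≤s (m+n≤o⇒m≤o∸n B B+s≤)) (m≤n⊔m 1 _)
    where
    B+s≤ : B + s ≤ suc (c + B)
    B+s≤ = subst (B + s ≤_) (trans (+-suc B c) (cong suc (+-comm B c))) (+-monoʳ-≤ B s≤c+1)

  ≤maxRun⇒runFits : ∀ {c B} → B ≤ maxRun (c + B) → RunFits c B
  ≤maxRun⇒runFits {c} {B} B≤max with B ≤? 1
  ... | yes B≤1 = ≤-trans B≤1 (s≤s z≤n) , inj₁ B≤1
  ... | no B≰1 with ⊔-sel 1 (s ⊓ (suc (c + B) ∸ s))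
  ...   | inj₁ max≡1 = ⊥-elim (B≰1 (subst (B ≤_) max≡1 B≤max))
  ...   | inj₂ max≡ = ≤-trans B≤⊓ (m⊓n≤m s _) , inj₂ s≤c+1
    where
    B≤⊓ = subst (B ≤_) max≡ B≤max
    B≤gap : B ≤ suc (c + B) ∸ s
    B≤gap = ≤-trans B≤⊓ (m⊓n≤n s _)
    s≤ : s ≤ suc (c + B)
    s≤ = <⇒≤ (m∸n≢0⇒n<m λ gap≡0 → B≰1 (≤-trans B≤gap (≤-trans (≤-reflexive gap≡0) z≤n)))
    s≤c+1 : s ≤ suc c
    s≤c+1 = +-cancelˡ-≤ B s (suc c)
      (subst (B + s ≤_) (sym (trans (+-suc B c) (cong suc (+-comm B c)))) (m≤o∸n⇒m+n≤o B s≤ B≤gap))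

  maxRun-suc≤ : ∀ m → maxRun (suc m) ≤ suc m
  maxRun-suc≤ m = ⊔-lub (s≤s z≤n) (≤-trans (m⊓n≤n s _) (m∸n≤m (suc m) s′))

  -- Enumeration by the length suc b of the last run, with fuel f ≥ n.
  mutual
    extensions : ℕ → ℕ → List (List ℕ)
    extensions _       zero    = [ [] ]
    extensions zero    (suc m) = []
    extensions (suc f) (suc m) = lastRunBelow f m (maxRun (suc m))

    lastRunBelow : ℕ → ℕ → ℕ → List (List ℕ)
    lastRunBelow f m zero    = []
    lastRunBelow f m (suc b) =
      lastRunBelow f m b ++ map (_++ decRun (m ∸ b) (suc b)) (extensions f (m ∸ b))

  ∈-lastRunBelow⁻ : ∀ f m k {v} → v ∈ lastRunBelow f m k →
    ∃[ b ] ∃[ w ] (b < k × w ∈ extensions f (m ∸ b) × v ≡ w ++ decRun (m ∸ b) (suc b))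
  ∈-lastRunBelow⁻ f m (suc k) v∈ with ∈-++⁻ (lastRunBelow f m k) v∈
  ... | inj₁ v∈ˡ with b , w , b<k , w∈ , eq ← ∈-lastRunBelow⁻ f m k v∈ˡ =
    b , w , m<n⇒m<1+n b<k , w∈ , eq
  ... | inj₂ v∈ʳ with w , w∈ , eq ← ∈-map⁻ (_++ decRun (m ∸ k) (suc k)) v∈ʳ =
    k , w , ≤-refl , w∈ , eq

  ∈-lastRunBelow⁺ : ∀ f m {k b w} → b < k → w ∈ extensions f (m ∸ b) →
    w ++ decRun (m ∸ b) (suc b) ∈ lastRunBelow f m k
  ∈-lastRunBelow⁺ f m {suc k} (s≤s b≤k) w∈ with m≤n⇒m<n∨m≡n b≤k
  ... | inj₁ b<k  = ∈-++⁺ˡ (∈-lastRunBelow⁺ f m b<k w∈)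
  ... | inj₂ refl = ∈-++⁺ʳ (lastRunBelow f m k) (∈-map⁺ (_++ decRun (m ∸ k) (suc k)) w∈)

  good-[] : Good′ s 0 []
  good-[] = record
    { permutation = ↭-refl
    ; ordered     = λ i< → ⊥-elim (n≮0 i<)
    ; avoids231   = λ (_ , _ , _ , _ , _ , k< , _) → n≮0 k<
    ; avoids312   = λ (_ , _ , _ , _ , _ , k< , _) → n≮0 k<
    }

  prefix+run≡ : ∀ {m b} → b ≤ m → m ∸ b + suc b ≡ suc m
  prefix+run≡ b≤m = m∸n+n≡m (s≤s b≤m)

  extensions-sound : ∀ {f n v} → n ≤ f → v ∈ extensions f n → Good′ s n v
  extensions-sound {n = zero} _ (here refl) = good-[]
  extensions-sound {suc f} {suc m} (s≤s m≤f) v∈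
    with b , w , b<max , w∈ , refl ← ∈-lastRunBelow⁻ f m (maxRun (suc m)) v∈ =
    subst (λ n → Good′ s n (w ++ decRun (m ∸ b) (suc b))) (prefix+run≡ b≤m)
      (good-++⁺ (≤maxRun⇒runFits (subst (λ n → suc b ≤ maxRun n) (sym (prefix+run≡ b≤m)) b<max))
                (extensions-sound (≤-trans (m∸n≤m m b) m≤f) w∈))
    where
    b≤m = ≤-pred (≤-trans b<max (maxRun-suc≤ m))

  extensions-complete : ∀ {f n v} → n ≤ f → Good′ s n v → v ∈ extensions f n
  extensions-complete {n = zero} _ good rewrite ↭-empty-inv (Good′.permutation good) = here refl
  extensions-complete {suc f} {suc m} (s≤s m≤f) good
    with b , w , b≤m , refl ←
      avoider-lastRun (Good′.permutation good) (Good′.avoids231 good) (Good′.avoids312 good)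
    with w-good , fits ←
      good-++⁻ (subst (λ n → Good′ s n (w ++ decRun (m ∸ b) (suc b))) (sym (prefix+run≡ b≤m)) good) =
    ∈-lastRunBelow⁺ f m (subst (λ n → suc b ≤ maxRun n) (prefix+run≡ b≤m) (runFits⇒≤maxRun fits))
      (extensions-complete (≤-trans (m∸n≤m m b) m≤f) w-good)

  extensions-unique : ∀ {f n} → n ≤ f → Unique (extensions f n)
  lastRunBelow-unique : ∀ {f m k} → m ≤ f → k ≤ suc m → Unique (lastRunBelow f m k)

  extensions-unique {n = zero} _ = All.[] ∷ []
  extensions-unique {suc f} {suc m} (s≤s m≤f) = lastRunBelow-unique m≤f (maxRun-suc≤ m)

  lastRunBelow-unique {k = zero} _ _ = []
  lastRunBelow-unique {f} {m} {suc b} m≤f (s≤s b≤m) =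
    Unique.++⁺ (lastRunBelow-unique m≤f (m≤n⇒m≤1+n b≤m))
               (Unique.map⁺ (++-cancelʳ run _ _) (extensions-unique (≤-trans (m∸n≤m m b) m≤f)))
               shorter-runs-differ
    where
    run = decRun (m ∸ b) (suc b)
    -- The top value suc m sits right after the prefix, and a shorter last run
    -- means a longer prefix, all of whose values are below suc m.
    shorter-runs-differ : ∀ {v} → ¬ (v ∈ lastRunBelow f m b × v ∈ map (_++ run) (extensions f (m ∸ b)))
    shorter-runs-differ (v∈ˡ , v∈ʳ)
      with b′ , w′ , b′<b , w′∈ , refl ← ∈-lastRunBelow⁻ f m b v∈ˡ
         | w , w∈ , eq ← ∈-map⁻ (_++ run) v∈ʳ = 1+n≰n (≤-trans top≤ (m∸n≤m m b′))
      where
      module W  = Good′ (extensions-sound (≤-trans (m∸n≤m m b) m≤f) w∈)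
      module W′ = Good′ (extensions-sound (≤-trans (m∸n≤m m b′) m≤f) w′∈)
      w<w′ : length w < length w′
      w<w′ = subst₂ _<_ (sym W.length≡) (sym W′.length≡) (∸-monoʳ-< b′<b b≤m)
      top≤ : suc m ≤ m ∸ b′
      top≤ = subst (_≤ m ∸ b′)
        (begin
          at w′ (length w)                               ≡⟨ at-++ˡ w′ _ w<w′ ⟨
          at (w′ ++ decRun (m ∸ b′) (suc b′)) (length w) ≡⟨ cong (λ v → at v (length w)) eq ⟩
          at (w ++ run) (length w)                       ≡⟨ at-length w _ ⟩
          suc (m ∸ b + b)                                ≡⟨ +-suc (m ∸ b) b ⟨
          m ∸ b + suc b                                  ≡⟨ prefix+run≡ b≤m ⟩
          suc m                                          ∎)
        (proj₂ (∈-ground⁻ (m ∸ b′) (∈-resp-↭ W′.permutation (at∈ w′ w<w′))))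
        where open ≡-Reasoning

  count : ℕ → ℕ
  count n = length (extensions n n)

  extensions-fuel : ∀ {f f′ n} → n ≤ f → n ≤ f′ → extensions f n ≡ extensions f′ n
  lastRunBelow-fuel : ∀ {f f′ m} k → m ≤ f → m ≤ f′ → lastRunBelow f m k ≡ lastRunBelow f′ m k

  extensions-fuel {n = zero} _ _ = refl
  extensions-fuel {suc f} {suc f′} {suc m} (s≤s m≤f) (s≤s m≤f′) =
    lastRunBelow-fuel (maxRun (suc m)) m≤f m≤f′

  lastRunBelow-fuel zero _ _ = refl
  lastRunBelow-fuel {m = m} (suc b) m≤f m≤f′ =
    cong₂ _++_ (lastRunBelow-fuel b m≤f m≤f′)
      (cong (map (_++ decRun (m ∸ b) (suc b)))
            (extensions-fuel (≤-trans (m∸n≤m m b) m≤f) (≤-trans (m∸n≤m m b) m≤f′)))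

  length-lastRunBelow : ∀ {f m} k → m ≤ f →
    length (lastRunBelow f m k) ≡ sumBelow (λ b → count (m ∸ b)) k
  length-lastRunBelow zero _ = refl
  length-lastRunBelow {f} {m} (suc b) m≤f = begin
    length (lastRunBelow f m b ++ map (_++ run) (extensions f (m ∸ b)))
      ≡⟨ length-++ (lastRunBelow f m b) ⟩
    length (lastRunBelow f m b) + length (map (_++ run) (extensions f (m ∸ b)))
      ≡⟨ cong₂ _+_ (length-lastRunBelow b m≤f) (length-map (_++ run) (extensions f (m ∸ b))) ⟩
    sumBelow (λ b → count (m ∸ b)) b + length (extensions f (m ∸ b))
      ≡⟨ cong (λ l → _ + length l) (extensions-fuel (≤-trans (m∸n≤m m b) m≤f) ≤-refl) ⟩
    sumBelow (λ b → count (m ∸ b)) b + count (m ∸ b) ∎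
    where
    open ≡-Reasoning
    run = decRun (m ∸ b) (suc b)

  count-suc : ∀ m → count (suc m) ≡ sumBelow (λ b → count (m ∸ b)) (maxRun (suc m))
  count-suc m = length-lastRunBelow (maxRun (suc m)) ≤-refl

  count-suc-suc : ∀ m {k} → maxRun (suc (suc m)) ≡ suc k →
    count (suc (suc m)) ≡ count (suc m) + sumBelow (λ b → count (m ∸ b)) k
  count-suc-suc m {k} max≡ =
    trans (count-suc (suc m)) (trans (cong (sumBelow _) max≡) (sumBelow-suc (λ b → count (suc m ∸ b)) k))

  maxRun-short : ∀ {n} → n ≤ s → maxRun n ≡ 1
  maxRun-short {n} n≤s =
    m≥n⇒m⊔n≡m (≤-trans (m⊓n≤n s _)
               (≤-trans (∸-monoˡ-≤ s′ n≤s) (≤-reflexive (m+n∸n≡m 1 s′))))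

  maxRun-mid : ∀ {t} → t < s → maxRun (s + t) ≡ suc t
  maxRun-mid {t} t<s = begin
    1 ⊔ (s ⊓ (suc (s′ + t) ∸ s′)) ≡⟨ cong (λ x → 1 ⊔ (s ⊓ (x ∸ s′))) (+-suc s′ t) ⟨
    1 ⊔ (s ⊓ (s′ + suc t ∸ s′))   ≡⟨ cong (λ x → 1 ⊔ (s ⊓ x)) (m+n∸m≡n s′ (suc t)) ⟩
    1 ⊔ (s ⊓ suc t)               ≡⟨ cong (1 ⊔_) (m≥n⇒m⊓n≡n t<s) ⟩
    1 ⊔ suc t                     ≡⟨ m≤n⇒m⊔n≡n (s≤s z≤n) ⟩
    suc t                         ∎
    where open ≡-Reasoning

  maxRun-long : ∀ {n} → s + s ≤ suc n → maxRun n ≡ s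
  maxRun-long 2s≤ =
    trans (cong (1 ⊔_) (m≤n⇒m⊓n≡m (m+n≤o⇒m≤o∸n s 2s≤))) (m≤n⇒m⊔n≡n (s≤s z≤n))

  count-short : ∀ n → n ≤ s → count n ≡ 1
  count-short zero    _     = refl
  count-short (suc m) m+1≤s = begin
    count (suc m)                                ≡⟨ count-suc m ⟩
    sumBelow (λ b → count (m ∸ b)) (maxRun (suc m)) ≡⟨ cong (sumBelow _) (maxRun-short m+1≤s) ⟩
    count m                                      ≡⟨ count-short m (≤-trans (n≤1+n m) m+1≤s) ⟩
    1                                            ∎
    where open ≡-Reasoning

  count-doubles : ∀ m → maxRun (suc (suc m)) ≡ suc (maxRun (suc m)) →
    count (suc (suc m)) ≡ 2 * count (suc m)
  count-doubles m max≡ = begin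
    count (suc (suc m))                          ≡⟨ count-suc-suc m max≡ ⟩
    count (suc m) + sumBelow h (maxRun (suc m))  ≡⟨ cong (count (suc m) +_) (count-suc m) ⟨
    count (suc m) + count (suc m)                ≡⟨ cong (count (suc m) +_) (+-identityʳ _) ⟨
    2 * count (suc m)                            ∎
    where
    open ≡-Reasoning
    h = λ b → count (m ∸ b)

  count-s+ : ∀ t → t < s → count (s + t) ≡ 2 ^ t
  count-s+ zero    _     = count-short (s + 0) (≤-reflexive (+-identityʳ s))
  count-s+ (suc t) t+1<s = begin
    count (s + suc t)    ≡⟨ cong count (+-suc s t) ⟩
    count (suc (s + t))  ≡⟨ count-doubles (s′ + t) maxRun-step ⟩
    2 * count (s + t)    ≡⟨ cong (2 *_) (count-s+ t t<s) ⟩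
    2 * 2 ^ t            ∎
    where
    open ≡-Reasoning
    t<s = <-trans (n<1+n t) t+1<s
    maxRun-step : maxRun (suc (s + t)) ≡ suc (maxRun (s + t))
    maxRun-step = begin
      maxRun (suc (s + t)) ≡⟨ cong maxRun (+-suc s t) ⟨
      maxRun (s + suc t)   ≡⟨ maxRun-mid t+1<s ⟩
      suc (suc t)          ≡⟨ cong suc (maxRun-mid t<s) ⟨
      suc (maxRun (s + t)) ∎

  count-middle : ∀ n → s < n → n < 2 * s → count n ≡ 2 ^ (n ∸ s)
  count-middle n s<n n<2s =
    subst (λ x → count x ≡ 2 ^ (n ∸ s)) (m+[n∸m]≡n s≤n) (count-s+ (n ∸ s) n∸s<s)
    where
    s≤n = <⇒≤ s<n
    n∸s<s : n ∸ s < s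
    n∸s<s = +-cancelˡ-< s _ _ (subst₂ _<_ (sym (m+[n∸m]≡n s≤n)) (cong (s +_) (+-identityʳ s)) n<2s)

  -- With both maximal runs equal to s, the two sums share all but one term.
  count-long : ∀ n → 2 * s ≤ n → count n + count (n ∸ s ∸ 1) ≡ 2 * count (n ∸ 1)
  count-long (suc zero) (s≤s 2s≤1) = ⊥-elim (m+1+n≢0 s′ (n≤0⇒n≡0 2s≤1))
  count-long (suc (suc m)) 2s≤n = begin
    count (suc (suc m)) + count (suc m ∸ s′ ∸ 1)   ≡⟨ cong₂ _+_ outer (cong count lag) ⟩
    count (suc m) + sumBelow h s′ + count (m ∸ s′) ≡⟨ +-assoc (count (suc m)) _ _ ⟩
    count (suc m) + sumBelow h s                   ≡⟨ cong (count (suc m) +_) inner ⟨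
    count (suc m) + count (suc m)                  ≡⟨ cong (count (suc m) +_) (+-identityʳ _) ⟨
    2 * count (suc m)                              ∎
    where
    open ≡-Reasoning
    h = λ b → count (m ∸ b)
    s+s≤ : s + s ≤ suc (suc m)
    s+s≤ = subst (_≤ suc (suc m)) (cong (s +_) (+-identityʳ s)) 2s≤n
    outer : count (suc (suc m)) ≡ count (suc m) + sumBelow h s′
    outer = count-suc-suc m (maxRun-long {suc (suc m)} (m≤n⇒m≤1+n s+s≤))
    inner : count (suc m) ≡ sumBelow h s
    inner = trans (count-suc m) (cong (sumBelow h) (maxRun-long {suc m} s+s≤))
    lag : suc m ∸ s′ ∸ 1 ≡ m ∸ s′
    lag = trans (∸-+-assoc (suc m) s′ 1) (cong (suc m ∸_) (+-comm s′ 1))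

theorem14 : (s : ℕ) → 1 ≤ s →
    Σ (ℕ → ℕ) λ f →
      (∀ n → ∃[ L ] (Unique L × (∀ v → (v ∈ L) ⇔ Good s n v) × length L ≡ f n)) ×
      (∀ n → n ≤ s → f n ≡ 1) ×
      (∀ n → s < n → n < 2 * s → f n ≡ 2 ^ (n ∸ s)) ×
      (∀ n → 2 * s ≤ n → f n + f (n ∸ s ∸ 1) ≡ 2 * f (n ∸ 1))
theorem14 (suc s′) _ = count , enumeration , count-short , count-middle , count-long
  where
  open UnevenComb s′
  enumeration : ∀ n → ∃[ L ] (Unique L × (∀ v → (v ∈ L) ⇔ Good (suc s′) n v) × length L ≡ count n)
  enumeration n = extensions n n , extensions-unique {n} ≤-refl ,
    (λ v → mk⇔ (good′⇒good ∘ extensions-sound ≤-refl) (extensions-complete ≤-refl ∘ good⇒good′)) ,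
    refl
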